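{- Let $n\ge 0$ and $0\le k\le n$. The number of pairs $(P,S)$, where $P$ is a Dyck path of semi-length $n+k+1$ and $S$ is a set of exactly $k$ $UDD$-patterns of $P$ none of which contains a down-step of the last run of down-steps of $P$, equals $B_{n,k}$.
   Context: A Dyck path of semi-length $m$ is a lattice path from $(0,0)$ to $(2m,0)$ with steps $U=(1,1)$ and $D=(1,-1)$ never going below the $x$-axis; it is identified with a word in $\{U,D\}$ of length $2m$. The last run of down-steps of $P$ is the maximal final block of consecutive $D$'s. A $UDD$-pattern is an occurrence of three consecutive letters $U,D,D$ in $P$. Catalan's triangle: $C_{n,s}=\frac{n-s+1}{n+1}\binom{n+s}{n}$; Borel's triangle: $B_{n,k}=\sum_{s=k}^{n}\binom{s}{k}C_{n,s}$. -}

module Defs where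

open import Data.Nat using (ℕ; zero; suc; _+_; _*_; _∸_; _<ᵇ_; _≡ᵇ_)
open import Data.Nat.DivMod using (_/_)
open import Data.Nat.Combinatorics using (_C_)
open import Data.Bool using (Bool; true; false; _∧_; if_then_else_)
open import Data.List using (List; []; _∷_; length; map; concatMap; drop; reverse; takeWhileᵇ; upTo; zip)
open import Data.Nat.ListAction using (sum)
open import Data.Product using (_×_; _,_)

data Step : Set where
  U D : Step

isD : Step → Bool
isD U = false
isD D = true

dyckFrom : ℕ → List Step → Bool
dyckFrom zero [] = true
dyckFrom (suc _) [] = false
dyckFrom h (U ∷ w) = dyckFrom (suc h) w
dyckFrom zero (D ∷ w) = false
dyckFrom (suc h) (D ∷ w) = dyckFrom h w

isDyck : List Step → Bool
isDyck = dyckFrom 0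

words : ℕ → List (List Step)
words zero = [] ∷ []
words (suc n) = concatMap (λ w → (U ∷ w) ∷ (D ∷ w) ∷ []) (words n)

-- all subsets of {0,…,n-1}, as characteristic vectors (lists of Bool of length n)
subsets : ℕ → List (List Bool)
subsets zero = [] ∷ []
subsets (suc n) = concatMap (λ s → (true ∷ s) ∷ (false ∷ s) ∷ []) (subsets n)

countTrue : List Bool → ℕ
countTrue [] = 0
countTrue (true ∷ s) = suc (countTrue s)
countTrue (false ∷ s) = countTrue s

startsUDD : List Step → Bool
startsUDD (U ∷ D ∷ D ∷ _) = true
startsUDD _ = false

lastRunStart : List Step → ℕ
lastRunStart w = length w ∸ length (takeWhileᵇ isD (reverse w))

-- a UDD-pattern occurrence starting at position i (steps i, i+1, i+2) that
-- contains no down-step of the last run of down-steps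
admissibleUDD : List Step → ℕ → Bool
admissibleUDD w i = startsUDD (drop i w) ∧ ((i + 2) <ᵇ lastRunStart w)

allB : {A : Set} → (A → Bool) → List A → Bool
allB p [] = true
allB p (x ∷ xs) = p x ∧ allB p xs

validSel : List Step → List Bool → Bool
validSel w s = allB (λ { (i , b) → if b then admissibleUDD w i else true }) (zip (upTo (length s)) s)

countPairs : ℕ → ℕ → ℕ
countPairs m k =
  sum (map (λ w → sum (map (λ s → if isDyck w ∧ validSel w s ∧ (countTrue s ≡ᵇ k) then 1 else 0)
                            (subsets (2 * m))))
           (words (2 * m)))

catalanTri : ℕ → ℕ → ℕ
catalanTri n s = ((suc n ∸ s) * ((n + s) C n)) / suc n

borelTri : ℕ → ℕ → ℕ
borelTri n k = sum (map (λ i → ((k + i) C k) * catalanTri n (k + i)) (upTo (suc n ∸ k)))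

module Submission where

-- A path that contains an up-step ends with its last U followed by the final run of down-steps, and a
-- UDD-pattern avoids that run exactly when some U comes after it. Deleting the last U and the final
-- run, and contracting every selected UDD to a single marked down-step, turns a pair (P, S) into a path
-- with n up-steps and some b ≤ n down-steps that never goes below the axis, with k of its down-steps
-- marked. Such paths number binom(b,k) C_{n,b}, C_{n,b} being the ballot number given by the reflection
-- principle. Rather than building this bijection, both sides are shown to obey the same recursion on
-- the first step.

open import Defs
open import Data.Nat using (ℕ; zero; suc; _+_; _*_; _∸_; _≤_; _<_; z≤n; s≤s; s≤s⁻¹; s<s⁻¹; _<ᵇ_; _≡ᵇ_)
open import Data.Nat.Properties
open import Data.Nat.DivMod using (_/_; m*n/n≡m)
open import Data.Nat.Combinatorics using (_C_; nCk+nC[k+1]≡[n+1]C[k+1]; k>n⇒nCk≡0; nC1≡n)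
open import Data.Nat.ListAction using (sum)
open import Data.Nat.ListAction.Properties using (sum-++)
open import Data.Nat.Tactic.RingSolver using (solve-∀)
open import Data.Bool using (Bool; true; false; _∧_; if_then_else_)
open import Data.Bool.Properties using (∧-zeroʳ; ∧-commutativeMonoid)
open import Data.List using (List; []; _∷_; _∷ʳ_; _++_; length; map; concatMap; drop; reverse; takeWhileᵇ; applyUpTo; zip)
open import Data.List.Properties using (map-++; drop-drop; drop-[]; unfold-reverse; reverse-involutive; length-reverse)
open import Data.Product using (_×_; _,_)
open import Algebra.Bundles using (CommutativeMonoid)
open import Algebra.Properties.CommutativeSemigroup +-commutativeSemigroup using (interchange)
open import Algebra.Properties.CommutativeSemigroup (CommutativeMonoid.commutativeSemigroup ∧-commutativeMonoid)
  using (x∙yz≈y∙xz)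
open import Relation.Binary.PropositionalEquality
open ≡-Reasoning

-- Finite sums

∑ : {A : Set} → List A → (A → ℕ) → ℕ
∑ xs f = sum (map f xs)

syntax ∑ xs (λ x → e) = ∑[ x ∈ xs ] e

∑-++ : {A : Set} (xs ys : List A) (f : A → ℕ) → ∑ (xs ++ ys) f ≡ ∑ xs f + ∑ ys f
∑-++ xs ys f = trans (cong sum (map-++ f xs ys)) (sum-++ (map f xs) (map f ys))

∑-concatMap : {A B : Set} (g : A → List B) (xs : List A) (f : B → ℕ) →
              ∑ (concatMap g xs) f ≡ ∑[ x ∈ xs ] ∑ (g x) f
∑-concatMap g []       f = refl
∑-concatMap g (x ∷ xs) f = trans (∑-++ (g x) (concatMap g xs) f) (cong (∑ (g x) f +_) (∑-concatMap g xs f))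

∑-+ : {A : Set} (xs : List A) (f g : A → ℕ) → ∑[ x ∈ xs ] (f x + g x) ≡ ∑ xs f + ∑ xs g
∑-+ []       f g = refl
∑-+ (x ∷ xs) f g = trans (cong (f x + g x +_) (∑-+ xs f g)) (interchange (f x) (g x) (∑ xs f) (∑ xs g))

∑-cong : {A : Set} (xs : List A) {f g : A → ℕ} → (∀ x → f x ≡ g x) → ∑ xs f ≡ ∑ xs g
∑-cong []       f≡g = refl
∑-cong (x ∷ xs) f≡g = cong₂ _+_ (f≡g x) (∑-cong xs f≡g)

∑-zero : {A : Set} (xs : List A) → ∑[ x ∈ xs ] 0 ≡ 0
∑-zero []       = refl
∑-zero (x ∷ xs) = ∑-zero xs

∑< : ℕ → (ℕ → ℕ) → ℕ
∑< zero    f = 0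
∑< (suc N) f = f 0 + ∑< N (λ i → f (suc i))

syntax ∑< N (λ i → e) = ∑[ i < N ] e

∑<-+ : ∀ N (f g : ℕ → ℕ) → ∑[ i < N ] (f i + g i) ≡ ∑< N f + ∑< N g
∑<-+ zero    f g = refl
∑<-+ (suc N) f g = trans (cong (f 0 + g 0 +_) (∑<-+ N (λ i → f (suc i)) (λ i → g (suc i)))) (interchange (f 0) (g 0) _ _)

∑<-cong : ∀ N {f g : ℕ → ℕ} → (∀ i → i < N → f i ≡ g i) → ∑< N f ≡ ∑< N g
∑<-cong zero    f≡g = refl
∑<-cong (suc N) f≡g = cong₂ _+_ (f≡g 0 (s≤s z≤n)) (∑<-cong N (λ i i<N → f≡g (suc i) (s≤s i<N)))

∑<-zero : ∀ N {f : ℕ → ℕ} → (∀ i → i < N → f i ≡ 0) → ∑< N f ≡ 0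
∑<-zero N f≡0 = trans (∑<-cong N f≡0) (zeros N)
  where
  zeros : ∀ N → ∑[ i < N ] 0 ≡ 0
  zeros zero    = refl
  zeros (suc N) = zeros N

∑<-split : ∀ k N (f : ℕ → ℕ) → ∑< (k + N) f ≡ ∑< k f + ∑[ i < N ] f (k + i)
∑<-split zero    N f = refl
∑<-split (suc k) N f = trans (cong (f 0 +_) (∑<-split k N (λ i → f (suc i)))) (sym (+-assoc (f 0) _ _))

∑-applyUpTo : ∀ (f g : ℕ → ℕ) N → ∑ (applyUpTo f N) g ≡ ∑[ i < N ] g (f i)
∑-applyUpTo f g zero    = refl
∑-applyUpTo f g (suc N) = cong (g (f 0) +_) (∑-applyUpTo (λ i → f (suc i)) g N)

pairSum : ℕ → (List Step → List Bool → ℕ) → ℕ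
pairSum L P = ∑[ w ∈ words L ] ∑[ s ∈ subsets L ] P w s

splitFirst : (List Step → List Bool → ℕ) → List Step → List Bool → ℕ
splitFirst P w s = (P (U ∷ w) (true ∷ s) + P (U ∷ w) (false ∷ s)) + (P (D ∷ w) (true ∷ s) + P (D ∷ w) (false ∷ s))

pairSum-cong : ∀ L {P Q} → (∀ w s → P w s ≡ Q w s) → pairSum L P ≡ pairSum L Q
pairSum-cong L P≡Q = ∑-cong (words L) (λ w → ∑-cong (subsets L) (P≡Q w))

pairSum-+ : ∀ L P Q → pairSum L (λ w s → P w s + Q w s) ≡ pairSum L P + pairSum L Q
pairSum-+ L P Q = trans (∑-cong (words L) (λ w → ∑-+ (subsets L) (P w) (Q w))) (∑-+ (words L) _ _)

pairSum-zero : ∀ L → pairSum L (λ _ _ → 0) ≡ 0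
pairSum-zero L = trans (∑-cong (words L) (λ _ → ∑-zero (subsets L))) (∑-zero (words L))

pairSum-suc : ∀ L P → pairSum (suc L) P ≡ pairSum L (splitFirst P)
pairSum-suc L P = begin
  ∑ (words (suc L)) (λ w → ∑ (subsets (suc L)) (P w))
    ≡⟨ ∑-concatMap _ (words L) _ ⟩
  ∑[ w ∈ words L ] (∑ (subsets (suc L)) (P (U ∷ w)) + (∑ (subsets (suc L)) (P (D ∷ w)) + 0))
    ≡⟨ ∑-cong (words L) (λ w → cong₂ _+_ (subsetsStep (P (U ∷ w)))
                                         (trans (+-identityʳ _) (subsetsStep (P (D ∷ w))))) ⟩
  ∑[ w ∈ words L ] (∑[ s ∈ subsets L ] (P (U ∷ w) (true ∷ s) + P (U ∷ w) (false ∷ s))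
                 + ∑[ s ∈ subsets L ] (P (D ∷ w) (true ∷ s) + P (D ∷ w) (false ∷ s)))
    ≡⟨ ∑-cong (words L) (λ w → sym (∑-+ (subsets L) _ _)) ⟩
  pairSum L (splitFirst P) ∎
  where
  subsetsStep : (f : List Bool → ℕ) → ∑ (subsets (suc L)) f ≡ ∑[ s ∈ subsets L ] (f (true ∷ s) + f (false ∷ s))
  subsetsStep f = trans (∑-concatMap _ (subsets L) f) (∑-cong (subsets L) (λ s → cong (f (true ∷ s) +_) (+-identityʳ _)))

pairSum-suc-split : ∀ L P A B C → (∀ w s → splitFirst P w s ≡ A w s + (B w s + C w s)) →
                    pairSum (suc L) P ≡ pairSum L A + (pairSum L B + pairSum L C)
pairSum-suc-split L P A B C split = begin
  pairSum (suc L) P                                     ≡⟨ pairSum-suc L P ⟩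
  pairSum L (splitFirst P)                              ≡⟨ pairSum-cong L split ⟩
  pairSum L (λ w s → A w s + (B w s + C w s))           ≡⟨ pairSum-+ L A _ ⟩
  pairSum L A + pairSum L (λ w s → B w s + C w s)       ≡⟨ cong (pairSum L A +_) (pairSum-+ L B C) ⟩
  pairSum L A + (pairSum L B + pairSum L C)             ∎

-- Admissible patterns

hasU : List Step → Bool
hasU []      = false
hasU (U ∷ _) = true
hasU (D ∷ w) = hasU w

admissibleAt : List Step → Bool
admissibleAt (U ∷ D ∷ D ∷ r) = hasU r
admissibleAt _               = false

validFrom : List Step → List Bool → Bool
validFrom w []      = true
validFrom w (b ∷ s) = (if b then admissibleAt w else true) ∧ validFrom (drop 1 w) s

hasU-drop-[] : ∀ j → hasU (drop j []) ≡ false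
hasU-drop-[] j = cong hasU (drop-[] j)

hasU-drop-∷ʳU : ∀ xs j → hasU (drop j (xs ∷ʳ U)) ≡ (j <ᵇ suc (length xs))
hasU-drop-∷ʳU []       zero    = refl
hasU-drop-∷ʳU []       (suc j) = hasU-drop-[] j
hasU-drop-∷ʳU (U ∷ xs) zero    = refl
hasU-drop-∷ʳU (D ∷ xs) zero    = hasU-drop-∷ʳU xs zero
hasU-drop-∷ʳU (x ∷ xs) (suc j) = hasU-drop-∷ʳU xs j

hasU-drop-∷ʳD : ∀ xs j → hasU (drop j (xs ∷ʳ D)) ≡ hasU (drop j xs)
hasU-drop-∷ʳD []       zero    = refl
hasU-drop-∷ʳD []       (suc j) = hasU-drop-[] j
hasU-drop-∷ʳD (U ∷ xs) zero    = refl
hasU-drop-∷ʳD (D ∷ xs) zero    = hasU-drop-∷ʳD xs zero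
hasU-drop-∷ʳD (x ∷ xs) (suc j) = hasU-drop-∷ʳD xs j

<ᵇ-lastRunStart : ∀ w j → (j <ᵇ lastRunStart w) ≡ hasU (drop j w)
<ᵇ-lastRunStart w j = begin
  j <ᵇ (length w ∸ length (takeWhileᵇ isD (reverse w)))
    ≡⟨ cong (λ n → j <ᵇ (n ∸ length (takeWhileᵇ isD (reverse w)))) (sym (length-reverse w)) ⟩
  j <ᵇ (length (reverse w) ∸ length (takeWhileᵇ isD (reverse w)))
    ≡⟨ reversed (reverse w) ⟩
  hasU (drop j (reverse (reverse w)))
    ≡⟨ cong (λ v → hasU (drop j v)) (reverse-involutive w) ⟩
  hasU (drop j w) ∎
  where
  reversed : ∀ r → (j <ᵇ (length r ∸ length (takeWhileᵇ isD r))) ≡ hasU (drop j (reverse r))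
  reversed []      = sym (hasU-drop-[] j)
  reversed (U ∷ r) = begin
    j <ᵇ suc (length r)                  ≡⟨ cong (λ n → j <ᵇ suc n) (sym (length-reverse r)) ⟩
    j <ᵇ suc (length (reverse r))        ≡⟨ sym (hasU-drop-∷ʳU (reverse r) j) ⟩
    hasU (drop j (reverse r ∷ʳ U))       ≡⟨ cong (λ v → hasU (drop j v)) (sym (unfold-reverse U r)) ⟩
    hasU (drop j (reverse (U ∷ r)))      ∎
  reversed (D ∷ r) = begin
    j <ᵇ (length r ∸ length (takeWhileᵇ isD r)) ≡⟨ reversed r ⟩
    hasU (drop j (reverse r))                   ≡⟨ sym (hasU-drop-∷ʳD (reverse r) j) ⟩
    hasU (drop j (reverse r ∷ʳ D))              ≡⟨ cong (λ v → hasU (drop j v)) (sym (unfold-reverse D r)) ⟩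
    hasU (drop j (reverse (D ∷ r)))             ∎

startsUDD∧hasU≡admissibleAt : ∀ v → startsUDD v ∧ hasU (drop 2 v) ≡ admissibleAt v
startsUDD∧hasU≡admissibleAt []                = refl
startsUDD∧hasU≡admissibleAt (U ∷ [])          = refl
startsUDD∧hasU≡admissibleAt (U ∷ U ∷ v)       = refl
startsUDD∧hasU≡admissibleAt (U ∷ D ∷ [])      = refl
startsUDD∧hasU≡admissibleAt (U ∷ D ∷ U ∷ v)   = refl
startsUDD∧hasU≡admissibleAt (U ∷ D ∷ D ∷ v)   = refl
startsUDD∧hasU≡admissibleAt (D ∷ v)           = refl

admissibleUDD≡admissibleAt : ∀ w i → admissibleUDD w i ≡ admissibleAt (drop i w)
admissibleUDD≡admissibleAt w i = begin
  startsUDD (drop i w) ∧ (i + 2 <ᵇ lastRunStart w)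
    ≡⟨ cong (startsUDD (drop i w) ∧_) (<ᵇ-lastRunStart w (i + 2)) ⟩
  startsUDD (drop i w) ∧ hasU (drop (i + 2) w)
    ≡⟨ cong (λ v → startsUDD (drop i w) ∧ hasU v) (sym (drop-drop i 2 w)) ⟩
  startsUDD (drop i w) ∧ hasU (drop 2 (drop i w))
    ≡⟨ startsUDD∧hasU≡admissibleAt (drop i w) ⟩
  admissibleAt (drop i w) ∎

validSel≡validFrom : ∀ w s → validSel w s ≡ validFrom w s
validSel≡validFrom w s =
  shifted _ (λ i → i) w s (λ i b → cong (λ x → if b then x else true) (admissibleUDD≡admissibleAt w i))
  where
  shifted : ∀ (H : ℕ × Bool → Bool) f v s →
            (∀ i b → H (f i , b) ≡ (if b then admissibleAt (drop i v) else true)) →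
            allB H (zip (applyUpTo f (length s)) s) ≡ validFrom v s
  shifted H f v []      H≡ = refl
  shifted H f v (b ∷ s) H≡ = cong₂ _∧_ (H≡ 0 b) (shifted H (λ i → f (suc i)) (drop 1 v) s
    (λ i b → trans (H≡ (suc i) b) (cong (λ u → if b then admissibleAt u else true) (sym (drop-drop 1 i v)))))

-- Counting selections by the first step

𝟙 : Bool → ℕ
𝟙 b = if b then 1 else 0

𝟙-∧-false : ∀ a → 𝟙 (a ∧ false) ≡ 0
𝟙-∧-false a = cong 𝟙 (∧-zeroʳ a)

-- validFrom is tested first so that a mark on a down-step kills the term by computation.
selected : (height marks : ℕ) → List Step → List Bool → Bool
selected h k w s = validFrom w s ∧ (dyckFrom h w ∧ (countTrue s ≡ᵇ k))

selections : (height marks length : ℕ) → ℕ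
selections h k L = pairSum L (λ w s → 𝟙 (selected h k w s))

selectionsWithU : (height marks length : ℕ) → ℕ
selectionsWithU h k L = pairSum L (λ w s → 𝟙 (hasU w ∧ selected h k w s))

-- Selections whose path starts with a marked UDD; the pattern takes height h+1 to h and is
-- admissible iff an up-step follows.
uddSelections : (height marks length : ℕ) → ℕ
uddSelections _       _       zero          = 0
uddSelections _       _       (suc zero)    = 0
uddSelections zero    _       (suc (suc L)) = 0
uddSelections (suc h) zero    (suc (suc L)) = 0
uddSelections (suc h) (suc k) (suc (suc L)) = selectionsWithU h k L

markedFirst : ℕ → ℕ → List Step → List Bool → ℕ
markedFirst h k w s = 𝟙 (selected h k (U ∷ w) (true ∷ s))

pairSum-markedFirst : ∀ h k L → pairSum L (markedFirst h k) ≡ uddSelections h k L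
pairSum-markedFirst h k zero          = refl
pairSum-markedFirst h k (suc zero)    = refl
pairSum-markedFirst h k (suc (suc L)) = begin
  pairSum (suc (suc L)) (markedFirst h k)               ≡⟨ pairSum-suc (suc L) (markedFirst h k) ⟩
  pairSum (suc L) (splitFirst (markedFirst h k))        ≡⟨ pairSum-suc L (splitFirst (markedFirst h k)) ⟩
  pairSum L (splitFirst (splitFirst (markedFirst h k))) ≡⟨ afterUDD h k ⟩
  uddSelections h k (suc (suc L))                       ∎
  where
  afterUDD : ∀ h k → pairSum L (splitFirst (splitFirst (markedFirst h k))) ≡ uddSelections h k (suc (suc L))
  afterUDD zero    k       = trans (pairSum-cong L vanishes) (pairSum-zero L)
    where
    vanishes : ∀ r s → splitFirst (splitFirst (markedFirst 0 k)) r s ≡ 0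
    vanishes r s with hasU r | validFrom r s
    ... | false | _     = refl
    ... | true  | false = refl
    ... | true  | true  = refl
  afterUDD (suc h) zero    = trans (pairSum-cong L vanishes) (pairSum-zero L)
    where
    vanishes : ∀ r s → splitFirst (splitFirst (markedFirst (suc h) 0)) r s ≡ 0
    vanishes r s with hasU r | validFrom r s
    ... | false | _     = refl
    ... | true  | false = refl
    ... | true  | true  = 𝟙-∧-false (dyckFrom h r)
  afterUDD (suc h) (suc k) = pairSum-cong L rest
    where
    rest : ∀ r s → splitFirst (splitFirst (markedFirst (suc h) (suc k))) r s ≡ 𝟙 (hasU r ∧ selected h k r s)
    rest r s with hasU r | validFrom r s
    ... | false | _     = refl
    ... | true  | false = refl
    ... | true  | true  = refl

markedFirst-ground : ∀ k L → pairSum L (markedFirst 0 k) + pairSum L (λ _ _ → 0) ≡ 0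
markedFirst-ground k L = cong₂ _+_ (trans (pairSum-markedFirst 0 k L) (ground L)) (pairSum-zero L)
  where
  ground : ∀ L → uddSelections 0 k L ≡ 0
  ground zero          = refl
  ground (suc zero)    = refl
  ground (suc (suc L)) = refl

[a+b]+[0+c]≡b+[a+c] : ∀ a b c → (a + b) + (0 + c) ≡ b + (a + c)
[a+b]+[0+c]≡b+[a+c] = solve-∀

selections-suc₀ : ∀ k L → selections 0 k (suc L) ≡ selections 1 k L
selections-suc₀ k L = begin
  selections 0 k (suc L)
    ≡⟨ pairSum-suc-split L _ (λ w s → 𝟙 (selected 1 k w s)) (markedFirst 0 k) (λ _ _ → 0) split ⟩
  selections 1 k L + (pairSum L (markedFirst 0 k) + pairSum L (λ _ _ → 0))
    ≡⟨ trans (cong (selections 1 k L +_) (markedFirst-ground k L)) (+-identityʳ _) ⟩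
  selections 1 k L ∎
  where
  split : ∀ w s → splitFirst (λ w s → 𝟙 (selected 0 k w s)) w s ≡ 𝟙 (selected 1 k w s) + (markedFirst 0 k w s + 0)
  split w s = trans (cong (λ x → (markedFirst 0 k w s + 𝟙 (selected 1 k w s)) + (0 + x)) (𝟙-∧-false (validFrom w s)))
                    ([a+b]+[0+c]≡b+[a+c] (markedFirst 0 k w s) _ 0)

selectionsWithU-suc₀ : ∀ k L → selectionsWithU 0 k (suc L) ≡ selections 1 k L
selectionsWithU-suc₀ k L = begin
  selectionsWithU 0 k (suc L)
    ≡⟨ pairSum-suc-split L _ (λ w s → 𝟙 (selected 1 k w s)) (markedFirst 0 k) (λ _ _ → 0) split ⟩
  selections 1 k L + (pairSum L (markedFirst 0 k) + pairSum L (λ _ _ → 0))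
    ≡⟨ trans (cong (selections 1 k L +_) (markedFirst-ground k L)) (+-identityʳ _) ⟩
  selections 1 k L ∎
  where
  split : ∀ w s → splitFirst (λ w s → 𝟙 (hasU w ∧ selected 0 k w s)) w s
                  ≡ 𝟙 (selected 1 k w s) + (markedFirst 0 k w s + 0)
  split w s = trans (cong₂ (λ x y → (markedFirst 0 k w s + 𝟙 (selected 1 k w s)) + (x + y))
                           (𝟙-∧-false (hasU w))
                           (cong 𝟙 (trans (cong (hasU w ∧_) (∧-zeroʳ (validFrom w s))) (∧-zeroʳ (hasU w)))))
                    ([a+b]+[0+c]≡b+[a+c] (markedFirst 0 k w s) _ 0)

selections-suc : ∀ h k L → selections (suc h) k (suc L)
                           ≡ selections (suc (suc h)) k L + (uddSelections (suc h) k L + selections h k L)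
selections-suc h k L = begin
  selections (suc h) k (suc L)
    ≡⟨ pairSum-suc-split L _ (λ w s → 𝟙 (selected (suc (suc h)) k w s)) (markedFirst (suc h) k)
                         (λ w s → 𝟙 (selected h k w s))
                         (λ w s → [a+b]+[0+c]≡b+[a+c] (markedFirst (suc h) k w s) _ _) ⟩
  selections (suc (suc h)) k L + (pairSum L (markedFirst (suc h) k) + selections h k L)
    ≡⟨ cong (λ x → selections (suc (suc h)) k L + (x + selections h k L)) (pairSum-markedFirst (suc h) k L) ⟩
  selections (suc (suc h)) k L + (uddSelections (suc h) k L + selections h k L) ∎

selectionsWithU-suc : ∀ h k L → selectionsWithU (suc h) k (suc L)
                                ≡ selections (suc (suc h)) k L + (uddSelections (suc h) k L + selectionsWithU h k L)
selectionsWithU-suc h k L = begin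
  selectionsWithU (suc h) k (suc L)
    ≡⟨ pairSum-suc-split L _ (λ w s → 𝟙 (selected (suc (suc h)) k w s)) (markedFirst (suc h) k)
                         (λ w s → 𝟙 (hasU w ∧ selected h k w s)) split ⟩
  selections (suc (suc h)) k L + (pairSum L (markedFirst (suc h) k) + selectionsWithU h k L)
    ≡⟨ cong (λ x → selections (suc (suc h)) k L + (x + selectionsWithU h k L)) (pairSum-markedFirst (suc h) k L) ⟩
  selections (suc (suc h)) k L + (uddSelections (suc h) k L + selectionsWithU h k L) ∎
  where
  split : ∀ w s → splitFirst (λ w s → 𝟙 (hasU w ∧ selected (suc h) k w s)) w s
                  ≡ 𝟙 (selected (suc (suc h)) k w s) + (markedFirst (suc h) k w s + 𝟙 (hasU w ∧ selected h k w s))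
  split w s = trans (cong (λ x → (markedFirst (suc h) k w s + 𝟙 (selected (suc (suc h)) k w s))
                                 + (x + 𝟙 (hasU w ∧ selected h k w s)))
                          (𝟙-∧-false (hasU w)))
                    ([a+b]+[0+c]≡b+[a+c] (markedFirst (suc h) k w s) _ _)

allDown : (height marks length : ℕ) → ℕ
allDown zero    _       (suc _) = 0
allDown zero    zero    zero    = 1
allDown (suc h) k       (suc L) = allDown h k L
allDown _       _       _       = 0

-- D^h is the only path without an up-step, and it has no admissible pattern.
selections≡allDown+selectionsWithU : ∀ h k L → selections h k L ≡ allDown h k L + selectionsWithU h k L
selections≡allDown+selectionsWithU zero    zero    zero    = refl
selections≡allDown+selectionsWithU zero    (suc k) zero    = refl
selections≡allDown+selectionsWithU (suc h) zero    zero    = refl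
selections≡allDown+selectionsWithU (suc h) (suc k) zero    = refl
selections≡allDown+selectionsWithU zero    k       (suc L) = trans (selections-suc₀ k L) (sym (selectionsWithU-suc₀ k L))
selections≡allDown+selectionsWithU (suc h) k       (suc L) = begin
  selections (suc h) k (suc L)
    ≡⟨ selections-suc h k L ⟩
  selections (suc (suc h)) k L + (uddSelections (suc h) k L + selections h k L)
    ≡⟨ cong (λ x → selections (suc (suc h)) k L + (uddSelections (suc h) k L + x))
            (selections≡allDown+selectionsWithU h k L) ⟩
  selections (suc (suc h)) k L + (uddSelections (suc h) k L + (allDown h k L + selectionsWithU h k L))
    ≡⟨ shuffle (selections (suc (suc h)) k L) (uddSelections (suc h) k L) (allDown h k L) (selectionsWithU h k L) ⟩
  allDown h k L + (selections (suc (suc h)) k L + (uddSelections (suc h) k L + selectionsWithU h k L))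
    ≡⟨ cong (allDown h k L +_) (sym (selectionsWithU-suc h k L)) ⟩
  allDown h k L + selectionsWithU (suc h) k (suc L) ∎
  where
  shuffle : ∀ a b c d → a + (b + (c + d)) ≡ c + (a + (b + d))
  shuffle = solve-∀

n+2*[1+m]≡2+[n+2*m] : ∀ n m → n + 2 * suc m ≡ 2 + (n + 2 * m)
n+2*[1+m]≡2+[n+2*m] = solve-∀

-- A path from height h with u up-steps has length h + 2u; every selected pattern, and a last
-- up-step, needs an up-step of its own.
mutual
  selections-short : ∀ h k L → L < h + 2 * k → selections h k L ≡ 0
  selections-short zero    zero    L       ()
  selections-short zero    (suc k) zero    _  = refl
  selections-short (suc h) k       zero    _  = refl
  selections-short zero    (suc k) (suc L) lt =
    trans (selections-suc₀ (suc k) L) (selections-short 1 (suc k) L (m<n⇒m<1+n (<⇒≤ lt)))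
  selections-short (suc h) k       (suc L) lt = begin
    selections (suc h) k (suc L)
      ≡⟨ selections-suc h k L ⟩
    selections (suc (suc h)) k L + (uddSelections (suc h) k L + selections h k L)
      ≡⟨ cong₂ _+_ (selections-short (suc (suc h)) k L (m<n⇒m<1+n (m<n⇒m<1+n lt′)))
                   (cong₂ _+_ (uddSelections-short h k L (m<n⇒m<1+n (m<n⇒m<1+n lt′))) (selections-short h k L lt′)) ⟩
    0 ∎
    where
    lt′ : L < h + 2 * k
    lt′ = s<s⁻¹ lt

  selectionsWithU-short : ∀ h k L → L < 2 + (h + 2 * k) → selectionsWithU h k L ≡ 0
  selectionsWithU-short h       k zero    _  = refl
  selectionsWithU-short zero    k (suc L) lt = trans (selectionsWithU-suc₀ k L) (selections-short 1 k L (s<s⁻¹ lt))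
  selectionsWithU-short (suc h) k (suc L) lt = begin
    selectionsWithU (suc h) k (suc L)
      ≡⟨ selectionsWithU-suc h k L ⟩
    selections (suc (suc h)) k L + (uddSelections (suc h) k L + selectionsWithU h k L)
      ≡⟨ cong₂ _+_ (selections-short (suc (suc h)) k L lt′)
                   (cong₂ _+_ (uddSelections-short h k L lt′) (selectionsWithU-short h k L lt′)) ⟩
    0 ∎
    where
    lt′ : L < 2 + (h + 2 * k)
    lt′ = s<s⁻¹ lt

  uddSelections-short : ∀ h k L → L < 2 + (h + 2 * k) → uddSelections (suc h) k L ≡ 0
  uddSelections-short h k       zero          _  = refl
  uddSelections-short h k       (suc zero)    _  = refl
  uddSelections-short h zero    (suc (suc L)) _  = refl
  uddSelections-short h (suc k) (suc (suc L)) lt =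
    selectionsWithU-short h k L (subst (L <_) (n+2*[1+m]≡2+[n+2*m] h k) (s<s⁻¹ (s<s⁻¹ lt)))

-- Paths with an up-step as marked ballot paths

bothZero : ℕ → ℕ → ℕ
bothZero zero    zero    = 1
bothZero zero    (suc _) = 0
bothZero (suc _) _       = 0

-- Words with a given number of up-steps, started at the given height, never going below 0, with the
-- given number of marked down-steps; a marked UDD contracts to a marked down-step.
mutual
  ballotMarked : (ups height marks : ℕ) → ℕ
  ballotMarked a h k = bothZero a k + ballotMarkedUp a h k + ballotMarkedDown a h k

  ballotMarkedUp : (ups height marks : ℕ) → ℕ
  ballotMarkedUp zero    h k = 0
  ballotMarkedUp (suc a) h k = ballotMarked a (suc h) k

  ballotMarkedDown : (ups height marks : ℕ) → ℕ
  ballotMarkedDown a zero    k       = 0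
  ballotMarkedDown a (suc h) zero    = ballotMarked a h zero
  ballotMarkedDown a (suc h) (suc k) = ballotMarked a h k + ballotMarked a h (suc k)

allDown≡bothZero : ∀ h a k → allDown h k (h + 2 * (a + k)) ≡ bothZero a k
allDown≡bothZero (suc h) a       k       = allDown≡bothZero h a k
allDown≡bothZero zero    zero    zero    = refl
allDown≡bothZero zero    zero    (suc k) = refl
allDown≡bothZero zero    (suc a) zero    = refl
allDown≡bothZero zero    (suc a) (suc k) = refl

mutual
  selectionsWithU≡ballotMarked : ∀ a h k → selectionsWithU h k (2 + (h + 2 * (a + k))) ≡ ballotMarked a h k
  selectionsWithU≡ballotMarked a zero    k       = begin
    selectionsWithU 0 k (2 + 2 * (a + k))  ≡⟨ selectionsWithU-suc₀ k (suc (2 * (a + k))) ⟩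
    selections 1 k (suc (2 * (a + k)))     ≡⟨ selections≡ballotMarkedUp a 0 k ⟩
    bothZero a k + ballotMarkedUp a 0 k    ≡⟨ sym (+-identityʳ _) ⟩
    ballotMarked a 0 k                     ∎
  selectionsWithU≡ballotMarked a (suc h) zero    = begin
    selectionsWithU (suc h) 0 (2 + (suc h + 2 * (a + 0)))
      ≡⟨ selectionsWithU-suc h 0 (suc (suc h + 2 * (a + 0))) ⟩
    selections (suc (suc h)) 0 (suc (suc h + 2 * (a + 0))) + (0 + selectionsWithU h 0 (2 + (h + 2 * (a + 0))))
      ≡⟨ cong₂ _+_ (selections≡ballotMarkedUp a (suc h) 0) (selectionsWithU≡ballotMarked a h 0) ⟩
    ballotMarked a (suc h) 0 ∎
  selectionsWithU≡ballotMarked a (suc h) (suc k) = begin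
    selectionsWithU (suc h) (suc k) (2 + (suc h + 2 * (a + suc k)))
      ≡⟨ selectionsWithU-suc h (suc k) (suc (suc h + 2 * (a + suc k))) ⟩
    selections (suc (suc h)) (suc k) (suc (suc h + 2 * (a + suc k)))
      + (selectionsWithU h k (h + 2 * (a + suc k)) + selectionsWithU h (suc k) (2 + (h + 2 * (a + suc k))))
      ≡⟨ cong₂ _+_ (selections≡ballotMarkedUp a (suc h) (suc k))
                   (cong₂ _+_ (trans (cong (selectionsWithU h k) afterUDD) (selectionsWithU≡ballotMarked a h k))
                              (selectionsWithU≡ballotMarked a h (suc k))) ⟩
    ballotMarked a (suc h) (suc k) ∎
    where
    afterUDD : h + 2 * (a + suc k) ≡ 2 + (h + 2 * (a + k))
    afterUDD = trans (cong (λ m → h + 2 * m) (+-suc a k)) (n+2*[1+m]≡2+[n+2*m] h (a + k))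

  selections≡ballotMarkedUp : ∀ a h k → selections (suc h) k (suc (h + 2 * (a + k))) ≡ bothZero a k + ballotMarkedUp a h k
  selections≡ballotMarkedUp a h k = begin
    selections (suc h) k (suc (h + 2 * (a + k)))
      ≡⟨ selections≡allDown+selectionsWithU (suc h) k (suc (h + 2 * (a + k))) ⟩
    allDown h k (h + 2 * (a + k)) + selectionsWithU (suc h) k (suc (h + 2 * (a + k)))
      ≡⟨ cong₂ _+_ (allDown≡bothZero h a k) (withU a) ⟩
    bothZero a k + ballotMarkedUp a h k ∎
    where
    withU : ∀ a → selectionsWithU (suc h) k (suc (h + 2 * (a + k))) ≡ ballotMarkedUp a h k
    withU zero    = selectionsWithU-short (suc h) k (suc (h + 2 * k)) (m<n⇒m<1+n (n<1+n (suc (h + 2 * k))))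
    withU (suc a) = trans (cong (λ L → selectionsWithU (suc h) k (suc L)) (n+2*[1+m]≡2+[n+2*m] h (a + k)))
                          (selectionsWithU≡ballotMarked a (suc h) k)

-- Ballot paths

mutual
  ballot : (ups height downs : ℕ) → ℕ
  ballot a h b = bothZero a b + ballotUp a h b + ballotDown a h b

  ballotUp : (ups height downs : ℕ) → ℕ
  ballotUp zero    h b = 0
  ballotUp (suc a) h b = ballot a (suc h) b

  ballotDown : (ups height downs : ℕ) → ℕ
  ballotDown a zero    b       = 0
  ballotDown a (suc h) zero    = 0
  ballotDown a (suc h) (suc b) = ballot a h b

ballotMarked≡∑ : ∀ a h k M → suc (a + h) ≤ M → ballotMarked a h k ≡ ∑[ b < M ] ((b C k) * ballot a h b)
ballotMarked≡∑ a h k M bound = sym (begin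
  ∑[ b < M ] ((b C k) * ballot a h b)
    ≡⟨ ∑<-cong M (λ b _ → distrib (b C k) (bothZero a b) (ballotUp a h b) (ballotDown a h b)) ⟩
  ∑[ b < M ] ((b C k) * bothZero a b + (b C k) * ballotUp a h b + (b C k) * ballotDown a h b)
    ≡⟨ trans (∑<-+ M _ _) (cong (_+ ∑[ b < M ] ((b C k) * ballotDown a h b)) (∑<-+ M _ _)) ⟩
  ∑[ b < M ] ((b C k) * bothZero a b) + ∑[ b < M ] ((b C k) * ballotUp a h b) + ∑[ b < M ] ((b C k) * ballotDown a h b)
    ≡⟨ cong₂ _+_ (cong₂ _+_ (emptyPart a k M bound) (upPart a bound)) (downPart h k M bound) ⟩
  ballotMarked a h k ∎)
  where
  distrib : ∀ c x y z → c * (x + y + z) ≡ c * x + c * y + c * z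
  distrib = solve-∀
  emptyPart : ∀ a k M → suc (a + h) ≤ M → ∑[ b < M ] ((b C k) * bothZero a b) ≡ bothZero a k
  emptyPart zero    zero    (suc M) _ = cong suc (∑<-zero M (λ i _ → *-zeroʳ (suc i C 0)))
  emptyPart zero    (suc k) (suc M) _ = ∑<-zero M (λ i _ → *-zeroʳ (suc i C suc k))
  emptyPart (suc a) k       M       _ = ∑<-zero M (λ b _ → *-zeroʳ (b C k))
  upPart : ∀ a → suc (a + h) ≤ M → ∑[ b < M ] ((b C k) * ballotUp a h b) ≡ ballotMarkedUp a h k
  upPart zero    _     = ∑<-zero M (λ b _ → *-zeroʳ (b C k))
  upPart (suc a) bound = sym (ballotMarked≡∑ a (suc h) k M (subst (_≤ M) (cong suc (sym (+-suc a h))) bound))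
  downPart : ∀ h k M → suc (a + h) ≤ M → ∑[ b < M ] ((b C k) * ballotDown a h b) ≡ ballotMarkedDown a h k
  downPart zero    k       M       _     = ∑<-zero M (λ b _ → *-zeroʳ (b C k))
  downPart (suc h) zero    (suc M) bound = sym (ballotMarked≡∑ a h 0 M (subst (_≤ M) (+-suc a h) (s≤s⁻¹ bound)))
  downPart (suc h) (suc k) (suc M) bound = begin
    (0 C suc k) * 0 + ∑[ b < M ] ((suc b C suc k) * ballot a h b)
      ≡⟨ ∑<-cong M (λ b _ → trans (cong (_* ballot a h b) (sym (nCk+nC[k+1]≡[n+1]C[k+1] b k)))
                                   (*-distribʳ-+ (ballot a h b) (b C k) (b C suc k))) ⟩
    ∑[ b < M ] ((b C k) * ballot a h b + (b C suc k) * ballot a h b)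
      ≡⟨ ∑<-+ M _ _ ⟩
    ∑[ b < M ] ((b C k) * ballot a h b) + ∑[ b < M ] ((b C suc k) * ballot a h b)
      ≡⟨ sym (cong₂ _+_ (ballotMarked≡∑ a h k M bound′) (ballotMarked≡∑ a h (suc k) M bound′)) ⟩
    ballotMarked a h k + ballotMarked a h (suc k) ∎
    where
    bound′ : suc (a + h) ≤ M
    bound′ = subst (_≤ M) (+-suc a h) (s≤s⁻¹ bound)

ballot-reflection₀ : ∀ h b → b ≤ suc h → ballot 0 h b + b C suc h ≡ 1
ballot-reflection₀ zero    zero          _  = refl
ballot-reflection₀ (suc h) zero          _  = refl
ballot-reflection₀ zero    (suc zero)    _  = refl
ballot-reflection₀ zero    (suc (suc b)) (s≤s ())
ballot-reflection₀ (suc h) (suc b)       le = begin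
  ballot 0 h b + suc b C suc (suc h)           ≡⟨ cong (ballot 0 h b +_) (sym (nCk+nC[k+1]≡[n+1]C[k+1] b (suc h))) ⟩
  ballot 0 h b + (b C suc h + b C suc (suc h)) ≡⟨ cong (λ x → ballot 0 h b + (b C suc h + x)) (k>n⇒nCk≡0 le) ⟩
  ballot 0 h b + (b C suc h + 0)               ≡⟨ cong (ballot 0 h b +_) (+-identityʳ _) ⟩
  ballot 0 h b + b C suc h                     ≡⟨ ballot-reflection₀ h b (s≤s⁻¹ le) ⟩
  1                                            ∎

-- By reflection in the line at height -1, (a + b) C suc (a + h) counts the words that go below 0.
mutual
  ballot-reflection : ∀ a h b → b ≤ suc (a + h) → ballot a h b + (a + b) C suc (a + h) ≡ (a + b) C a
  ballot-reflection zero    h b le = ballot-reflection₀ h b le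
  ballot-reflection (suc a) h b le = begin
    ballot a (suc h) b + ballotDown (suc a) h b + suc (a + b) C suc (suc (a + h))
      ≡⟨ cong (ballot a (suc h) b + ballotDown (suc a) h b +_) (sym (nCk+nC[k+1]≡[n+1]C[k+1] (a + b) (suc (a + h)))) ⟩
    ballot a (suc h) b + ballotDown (suc a) h b + ((a + b) C suc (a + h) + (a + b) C suc (suc (a + h)))
      ≡⟨ regroup (ballot a (suc h) b) (ballotDown (suc a) h b) ((a + b) C suc (a + h)) ((a + b) C suc (suc (a + h))) ⟩
    (ballot a (suc h) b + (a + b) C suc (suc (a + h))) + (ballotDown (suc a) h b + (a + b) C suc (a + h))
      ≡⟨ cong₂ _+_ up (ballotDown-reflection a h b le) ⟩
    (a + b) C a + (a + b) C suc a
      ≡⟨ nCk+nC[k+1]≡[n+1]C[k+1] (a + b) a ⟩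
    suc (a + b) C suc a ∎
    where
    regroup : ∀ x y z w → x + y + (z + w) ≡ (x + w) + (y + z)
    regroup = solve-∀
    up : ballot a (suc h) b + (a + b) C suc (suc (a + h)) ≡ (a + b) C a
    up = subst (λ n → ballot a (suc h) b + (a + b) C suc n ≡ (a + b) C a) (+-suc a h)
               (ballot-reflection a (suc h) b (subst (b ≤_) (cong suc (sym (+-suc a h))) le))

  ballotDown-reflection : ∀ a h b → b ≤ suc (suc (a + h)) →
                          ballotDown (suc a) h b + (a + b) C suc (a + h) ≡ (a + b) C suc a
  ballotDown-reflection a zero    b       _  = cong (λ n → (a + b) C suc n) (+-identityʳ a)
  ballotDown-reflection a (suc h) zero    _  = begin
    (a + 0) C suc (a + suc h) ≡⟨ k>n⇒nCk≡0 (s≤s (≤-trans (≤-reflexive (+-identityʳ a)) (m≤m+n a (suc h)))) ⟩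
    0                         ≡⟨ sym (k>n⇒nCk≡0 (s≤s (≤-reflexive (+-identityʳ a)))) ⟩
    (a + 0) C suc a           ∎
  ballotDown-reflection a (suc h) (suc b) le rewrite +-suc a b | +-suc a h =
    ballot-reflection (suc a) h b (s≤s⁻¹ le)

m*[k+m]Ck≡[1+k]*[k+m]C[1+k] : ∀ k m → m * ((k + m) C k) ≡ suc k * ((k + m) C suc k)
m*[k+m]Ck≡[1+k]*[k+m]C[1+k] zero    m       = trans (*-identityʳ m) (sym (trans (+-identityʳ _) (nC1≡n m)))
m*[k+m]Ck≡[1+k]*[k+m]C[1+k] (suc k) zero    =
  sym (trans (cong (suc (suc k) *_) (k>n⇒nCk≡0 (s≤s (≤-reflexive (+-identityʳ (suc k)))))) (*-zeroʳ (suc (suc k))))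
m*[k+m]Ck≡[1+k]*[k+m]C[1+k] (suc k) (suc m) = begin
  suc m * (suc N C suc k)
    ≡⟨ cong (suc m *_) (sym (nCk+nC[k+1]≡[n+1]C[k+1] N k)) ⟩
  suc m * (N C k + N C suc k)
    ≡⟨ *-distribˡ-+ (suc m) (N C k) (N C suc k) ⟩
  suc m * (N C k) + (N C suc k + m * (N C suc k))
    ≡⟨ cong₂ (λ x y → x + (N C suc k + y)) (m*[k+m]Ck≡[1+k]*[k+m]C[1+k] k (suc m)) shifted ⟩
  suc k * (N C suc k) + (N C suc k + suc (suc k) * (N C suc (suc k)))
    ≡⟨ collect (suc k) (N C suc k) (N C suc (suc k)) ⟩
  suc (suc k) * (N C suc k + N C suc (suc k))
    ≡⟨ cong (suc (suc k) *_) (nCk+nC[k+1]≡[n+1]C[k+1] N (suc k)) ⟩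
  suc (suc k) * (suc N C suc (suc k)) ∎
  where
  N : ℕ
  N = k + suc m
  shifted : m * (N C suc k) ≡ suc (suc k) * (N C suc (suc k))
  shifted = subst (λ n → m * (n C suc k) ≡ suc (suc k) * (n C suc (suc k))) (sym (+-suc k m))
                  (m*[k+m]Ck≡[1+k]*[k+m]C[1+k] (suc k) m)
  collect : ∀ j x y → j * x + (x + suc j * y) ≡ suc j * (x + y)
  collect = solve-∀

ballot≡catalanTri : ∀ n s → s ≤ n → ballot n 0 s ≡ catalanTri n s
ballot≡catalanTri n s s≤n = sym (trans (cong (_/ suc n) numerator) (m*n/n≡m (ballot n 0 s) (suc n)))
  where
  X R B : ℕ
  X = (n + s) C n
  R = (n + s) C suc n
  B = ballot n 0 s
  reflection : B + R ≡ X
  reflection = subst (λ m → B + (n + s) C suc m ≡ X) (+-identityʳ n)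
                     (ballot-reflection n 0 s (subst (s ≤_) (cong suc (sym (+-identityʳ n))) (m≤n⇒m≤1+n s≤n)))
  numerator : (suc n ∸ s) * X ≡ B * suc n
  numerator = +-cancelʳ-≡ (s * X) _ _ (begin
    (suc n ∸ s) * X + s * X   ≡⟨ sym (*-distribʳ-+ X (suc n ∸ s) s) ⟩
    (suc n ∸ s + s) * X       ≡⟨ cong (_* X) (m∸n+n≡m (m≤n⇒m≤1+n s≤n)) ⟩
    suc n * X                 ≡⟨ cong (suc n *_) (sym reflection) ⟩
    suc n * (B + R)           ≡⟨ *-distribˡ-+ (suc n) B R ⟩
    suc n * B + suc n * R     ≡⟨ cong₂ _+_ (*-comm (suc n) B) (sym (m*[k+m]Ck≡[1+k]*[k+m]C[1+k] n s)) ⟩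
    B * suc n + s * X         ∎)

countPairs≡selections : ∀ m k → countPairs m k ≡ selections 0 k (2 * m)
countPairs≡selections m k = pairSum-cong (2 * m) (λ w s → cong 𝟙 (begin
  dyckFrom 0 w ∧ (validSel w s ∧ (countTrue s ≡ᵇ k))
    ≡⟨ cong (λ v → dyckFrom 0 w ∧ (v ∧ (countTrue s ≡ᵇ k))) (validSel≡validFrom w s) ⟩
  dyckFrom 0 w ∧ (validFrom w s ∧ (countTrue s ≡ᵇ k))
    ≡⟨ x∙yz≈y∙xz (dyckFrom 0 w) (validFrom w s) (countTrue s ≡ᵇ k) ⟩
  selected 0 k w s ∎))

proposition1 : (n k : ℕ) → k ≤ n → countPairs (n + k + 1) k ≡ borelTri n k
proposition1 n k k≤n = begin
  countPairs (n + k + 1) k                  ≡⟨ countPairs≡selections (n + k + 1) k ⟩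
  selections 0 k (2 * (n + k + 1))          ≡⟨ cong (selections 0 k) (length≡ n k) ⟩
  selections 0 k (2 + 2 * (n + k))          ≡⟨ selections≡allDown+selectionsWithU 0 k (2 + 2 * (n + k)) ⟩
  selectionsWithU 0 k (2 + 2 * (n + k))     ≡⟨ selectionsWithU≡ballotMarked n 0 k ⟩
  ballotMarked n 0 k                        ≡⟨ ballotMarked≡∑ n 0 k (suc n) (s≤s (≤-reflexive (+-identityʳ n))) ⟩
  ∑< (suc n) term                           ≡⟨ cong (λ N → ∑< N term) (sym (m+[n∸m]≡n k≤1+n)) ⟩
  ∑< (k + (suc n ∸ k)) term                 ≡⟨ ∑<-split k (suc n ∸ k) term ⟩
  ∑< k term + ∑[ i < suc n ∸ k ] term (k + i)
    ≡⟨ cong₂ _+_ (∑<-zero k (λ b b<k → cong (_* ballot n 0 b) (k>n⇒nCk≡0 b<k))) (∑<-cong (suc n ∸ k) catalan) ⟩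
  ∑[ i < suc n ∸ k ] (((k + i) C k) * catalanTri n (k + i))
    ≡⟨ sym (∑-applyUpTo (λ i → i) _ (suc n ∸ k)) ⟩
  borelTri n k ∎
  where
  term : ℕ → ℕ
  term b = (b C k) * ballot n 0 b
  length≡ : ∀ n k → 2 * (n + k + 1) ≡ 2 + 2 * (n + k)
  length≡ = solve-∀
  k≤1+n : k ≤ suc n
  k≤1+n = m≤n⇒m≤1+n k≤n
  catalan : ∀ i → i < suc n ∸ k → term (k + i) ≡ ((k + i) C k) * catalanTri n (k + i)
  catalan i i<1+n∸k = cong (((k + i) C k) *_) (ballot≡catalanTri n (k + i) k+i≤n)
    where
    k+i≤n : k + i ≤ n
    k+i≤n = subst (_≤ n) (+-comm i k) (s≤s⁻¹ (m≤o∸n⇒m+n≤o (suc i) k≤1+n i<1+n∸k))
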